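{- Let $q\ge1$. Let $u_{n,q}$ be the total number of occurrences of $1$ over all $q$-decreasing binary words of length $n$, and $v_{n,q}$ the total number of occurrences of $1$ over all binary words of length $n$ without the factor $1^{q+1}$. Then $$\lim_{n\to\infty}\frac{u_{n,q}-v_{n,q}}{n\cdot f_{n+q+1,q+1}}=0,$$ where $f_{n,k}$ are the $k$-generalized Fibonacci numbers.
   Context: A binary word is $q$-decreasing ($q\ge1$) if each of its maximal factors (maximal blocks of consecutive letters) of the form $0^a1^b$ with $a>0$ satisfies $q\cdot a>b$. The $k$-generalized Fibonacci numbers are defined by $f_{n,k}=0$ for $0\le n\le k-2$, $f_{k-1,k}=1$, and $f_{n,k}=\sum_{i=1}^k f_{n-i,k}$ for $n\ge k$; $f_{n+q+1,q+1}$ equals the number of binary words of length $n$ with no factor $1^{q+1}$. -}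

module Defs where

open import Data.Bool using (Bool; true; false; _∧_; _∨_; if_then_else_)
open import Data.Nat using (ℕ; zero; suc; _+_; _*_; _∸_; _<ᵇ_; _≡ᵇ_)
open import Data.List using (List; []; _∷_; map; _++_; take; filterᵇ; replicate)
open import Data.Nat.ListAction using (sum)

-- Binary words are lists of Bool, with  false = letter 0  and  true = letter 1.
Word : Set
Word = List Bool

words : ℕ → List Word
words zero    = [] ∷ []
words (suc n) = map (false ∷_) (words n) ++ map (true ∷_) (words n)

ones : Word → ℕ
ones []           = 0
ones (false ∷ w)  = ones w
ones (true ∷ w)   = suc (ones w)

-- The maximal factors of the form 0^a 1^b with a > 0 are
-- exactly: a maximal run of 0s (length a) followed by the whole run of 1s
-- immediately after it (length b ≥ 0).  Leading 1s of the word belong to no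
-- such factor.
-- blockCheck q a b w : we are inside such a factor, having read a ≥ 1 zeros
-- and then b ones; w is the remaining suffix.
blockCheck : ℕ → ℕ → ℕ → Word → Bool
blockCheck q a b       []          = b <ᵇ q * a
blockCheck q a zero    (false ∷ w) = blockCheck q (suc a) zero w
blockCheck q a (suc b) (false ∷ w) = (suc b <ᵇ q * a) ∧ blockCheck q 1 0 w
blockCheck q a b       (true ∷ w)  = blockCheck q a (suc b) w

-- isQDecreasing q w = true  iff  every maximal factor 0^a 1^b (a > 0) of w
-- satisfies q * a > b.
isQDecreasing : ℕ → Word → Bool
isQDecreasing q []          = true
isQDecreasing q (true ∷ w)  = isQDecreasing q w
isQDecreasing q (false ∷ w) = blockCheck q 1 0 w

isPrefix : Word → Word → Bool
isPrefix []      w       = true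
isPrefix (x ∷ p) []      = false
isPrefix (true ∷ p)  (true ∷ w)  = isPrefix p w
isPrefix (false ∷ p) (false ∷ w) = isPrefix p w
isPrefix (true ∷ p)  (false ∷ w) = false
isPrefix (false ∷ p) (true ∷ w)  = false

hasFactor : Word → Word → Bool
hasFactor p []       = isPrefix p []
hasFactor p (x ∷ w)  = isPrefix p (x ∷ w) ∨ hasFactor p w

avoids1Run : ℕ → Word → Bool
avoids1Run q w = if hasFactor (replicate (suc q) true) w then false else true

u : ℕ → ℕ → ℕ
u n q = sum (map ones (filterᵇ (isQDecreasing q) (words n)))

v : ℕ → ℕ → ℕ
v n q = sum (map ones (filterᵇ (avoids1Run q) (words n)))

-- k-generalized Fibonacci numbers f_{n,k}:
--   f_{n,k} = 0 for 0 ≤ n ≤ k-2, f_{k-1,k} = 1, f_{n,k} = Σ_{i=1}^k f_{n-i,k} (n ≥ k).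
-- fibHist k n = [f_{n,k}, f_{n-1,k}, …, f_{0,k}].
fibVal : ℕ → ℕ → List ℕ → ℕ
fibVal k m hist =
  if m <ᵇ k ∸ 1 then 0 else (if m ≡ᵇ k ∸ 1 then 1 else sum (take k hist))

fibHist : ℕ → ℕ → List ℕ
fibHist k zero    = fibVal k 0 [] ∷ []
fibHist k (suc n) = fibVal k (suc n) (fibHist k n) ∷ fibHist k n

f : ℕ → ℕ → ℕ
f n k with fibHist k n
... | []    = 0
... | x ∷ _ = x

module Submission where

-- Tally a set of words by the pair (number of words, total number of 1s). Splitting off the
-- leading run of 1s expresses the tallies of the q-decreasing words and of the words avoiding
-- 1^(q+1) through the tallies of the suffixes that follow the run and its closing 0. For
-- q-decreasing words these suffixes are the words w with 0w q-decreasing; they have exactly the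
-- tallies of the avoiding words whose leading run is shorter than q, because both families obey
-- the same recursion (Recurrence). Comparing leading runs then gives u_{n,q} = v_{n,q} + t_n with
-- t_n = 0 for n ≤ q and t_{n+q+1} = t_n + f_{n+q+1,q+1}, where f_{n+q+1,q+1} counts the avoiding
-- words of length n. Hence 0 ≤ u_{n,q} - v_{n,q} ≤ f_{n+q+1,q+1}, and the quotient is at most 1/n.

open import Defs

module Counting where
  open import Algebra.Bundles using (CommutativeMonoid)
  open import Data.Bool using (Bool; true; false; not; _∧_; _∨_; if_then_else_)
  open import Data.Bool.Properties using (T-≡)
  open import Data.List using (List; []; _∷_; map; _++_; filterᵇ; replicate; take)
  open import Data.Nat
  open import Data.Nat.Induction using (<-rec)
  open import Data.Nat.ListAction using (sum)
  open import Data.Nat.Properties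
  open import Data.Nat.Tactic.RingSolver using (solve-∀)
  open import Data.Product using (_×_; _,_; proj₁; proj₂; ∃-syntax)
  open import Function.Bundles using (Equivalence)
  open import Relation.Binary.PropositionalEquality
  open import Relation.Nullary using (yes; no)

  Tally : Set
  Tally = ℕ × ℕ

  #words #ones : Tally → ℕ
  #words = proj₁
  #ones  = proj₂

  0ᵗ 1ᵗ : Tally
  0ᵗ = 0 , 0
  1ᵗ = 1 , 0

  infixl 6 _⊕_
  _⊕_ : Tally → Tally → Tally
  (a , b) ⊕ (c , d) = a + c , b + d

  ⊕-assoc : ∀ x y z → x ⊕ y ⊕ z ≡ x ⊕ (y ⊕ z)
  ⊕-assoc (a , b) (c , d) (e , f) = cong₂ _,_ (+-assoc a c e) (+-assoc b d f)

  ⊕-comm : ∀ x y → x ⊕ y ≡ y ⊕ x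
  ⊕-comm (a , b) (c , d) = cong₂ _,_ (+-comm a c) (+-comm b d)

  ⊕-identityʳ : ∀ x → x ⊕ 0ᵗ ≡ x
  ⊕-identityʳ (a , b) = cong₂ _,_ (+-identityʳ a) (+-identityʳ b)

  ⊕-0ᵗ-commutativeMonoid : CommutativeMonoid _ _
  ⊕-0ᵗ-commutativeMonoid = record
    { _∙_ = _⊕_
    ; ε   = 0ᵗ
    ; isCommutativeMonoid = record
      { isMonoid = record
        { isSemigroup = record
          { isMagma = record { isEquivalence = isEquivalence ; ∙-cong = cong₂ _⊕_ }
          ; assoc = ⊕-assoc }
        ; identity = (λ _ → refl) , ⊕-identityʳ }
      ; comm = ⊕-comm } }

  open import Algebra.Properties.CommutativeSemigroup
    (CommutativeMonoid.commutativeSemigroup ⊕-0ᵗ-commutativeMonoid)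
    using (interchange; xy∙z≈xz∙y)
  open import Algebra.Solver.CommutativeMonoid ⊕-0ᵗ-commutativeMonoid
    using (solve; _⊜_) renaming (_⊕_ to _⊕ᵉ_)

  -- The tally of the words 1w for w counted by x.
  prepend1 : Tally → Tally
  prepend1 (c , o) = c , c + o

  prepend1^ : ℕ → Tally → Tally
  prepend1^ zero    x = x
  prepend1^ (suc k) x = prepend1 (prepend1^ k x)

  prepend1-⊕ : ∀ x y → prepend1 (x ⊕ y) ≡ prepend1 x ⊕ prepend1 y
  prepend1-⊕ (a , b) (c , d) = cong (a + c ,_) (lemma a b c d)
    where lemma : ∀ a b c d → a + c + (b + d) ≡ a + b + (c + d)
          lemma = solve-∀

  prepend1-as-⊕ : ∀ x → prepend1 x ≡ x ⊕ (0 , #words x)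
  prepend1-as-⊕ (c , o) = cong₂ _,_ (sym (+-identityʳ c)) (+-comm c o)

  prepend1^-⊕ : ∀ k x y → prepend1^ k (x ⊕ y) ≡ prepend1^ k x ⊕ prepend1^ k y
  prepend1^-⊕ zero    x y = refl
  prepend1^-⊕ (suc k) x y =
    trans (cong prepend1 (prepend1^-⊕ k x y)) (prepend1-⊕ (prepend1^ k x) (prepend1^ k y))

  prepend1^-prepend1 : ∀ k x → prepend1^ k (prepend1 x) ≡ prepend1 (prepend1^ k x)
  prepend1^-prepend1 zero    x = refl
  prepend1^-prepend1 (suc k) x = cong prepend1 (prepend1^-prepend1 k x)

  prepend1^-no-words : ∀ k t → prepend1^ k (0 , t) ≡ (0 , t)
  prepend1^-no-words zero    t = refl
  prepend1^-no-words (suc k) t = cong prepend1 (prepend1^-no-words k t)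

  #words-prepend1^ : ∀ k x → #words (prepend1^ k x) ≡ #words x
  #words-prepend1^ zero    x = refl
  #words-prepend1^ (suc k) x = #words-prepend1^ k x

  prepend1^-suc-⊕ : ∀ k x t →
    prepend1^ (suc k) (x ⊕ (0 , t)) ≡ prepend1^ k x ⊕ (0 , #words x + t)
  prepend1^-suc-⊕ k x t = begin
    prepend1 (prepend1^ k (x ⊕ (0 , t)))
      ≡⟨ cong prepend1 (prepend1^-⊕ k x (0 , t)) ⟩
    prepend1 (y ⊕ prepend1^ k (0 , t))
      ≡⟨ cong (λ z → prepend1 (y ⊕ z)) (prepend1^-no-words k t) ⟩
    prepend1 (y ⊕ (0 , t))
      ≡⟨ prepend1-as-⊕ (y ⊕ (0 , t)) ⟩
    y ⊕ (0 , t) ⊕ (0 , #words y + 0)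
      ≡⟨ cong (λ c → y ⊕ (0 , t) ⊕ (0 , c)) (trans (+-identityʳ _) (#words-prepend1^ k x)) ⟩
    y ⊕ (0 , t) ⊕ (0 , #words x)
      ≡⟨ ⊕-assoc y (0 , t) (0 , #words x) ⟩
    y ⊕ (0 , t + #words x)
      ≡⟨ cong (λ c → y ⊕ (0 , c)) (+-comm t (#words x)) ⟩
    y ⊕ (0 , #words x + t) ∎
    where
    open ≡-Reasoning
    y = prepend1^ k x

  tallyOf : (Word → Bool) → List Word → Tally
  tallyOf p []       = 0ᵗ
  tallyOf p (w ∷ ws) = (if p w then (1 , ones w) else 0ᵗ) ⊕ tallyOf p ws

  tally : (Word → Bool) → ℕ → Tally
  tally p n = tallyOf p (words n)

  tallyOf-++ : ∀ p xs ys → tallyOf p (xs ++ ys) ≡ tallyOf p xs ⊕ tallyOf p ys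
  tallyOf-++ p []       ys = refl
  tallyOf-++ p (x ∷ xs) ys =
    trans (cong (_ ⊕_) (tallyOf-++ p xs ys)) (sym (⊕-assoc _ (tallyOf p xs) (tallyOf p ys)))

  tallyOf-map-false∷ : ∀ p ws → tallyOf p (map (false ∷_) ws) ≡ tallyOf (λ w → p (false ∷ w)) ws
  tallyOf-map-false∷ p []       = refl
  tallyOf-map-false∷ p (w ∷ ws) = cong (_ ⊕_) (tallyOf-map-false∷ p ws)

  tallyOf-map-true∷ : ∀ p ws →
    tallyOf p (map (true ∷_) ws) ≡ prepend1 (tallyOf (λ w → p (true ∷ w)) ws)
  tallyOf-map-true∷ p []       = refl
  tallyOf-map-true∷ p (w ∷ ws) =
    trans (cong₂ _⊕_ (prepend1-single (p (true ∷ w))) (tallyOf-map-true∷ p ws))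
          (sym (prepend1-⊕ _ (tallyOf (λ w → p (true ∷ w)) ws)))
    where
    prepend1-single : ∀ b →
      (if b then (1 , suc (ones w)) else 0ᵗ) ≡ prepend1 (if b then (1 , ones w) else 0ᵗ)
    prepend1-single true  = refl
    prepend1-single false = refl

  tally-suc : ∀ p n →
    tally p (suc n) ≡ tally (λ w → p (false ∷ w)) n ⊕ prepend1 (tally (λ w → p (true ∷ w)) n)
  tally-suc p n =
    trans (tallyOf-++ p (map (false ∷_) (words n)) (map (true ∷_) (words n)))
          (cong₂ _⊕_ (tallyOf-map-false∷ p (words n)) (tallyOf-map-true∷ p (words n)))

  tallyOf-cong : ∀ {p r} → (∀ w → p w ≡ r w) → ∀ ws → tallyOf p ws ≡ tallyOf r ws
  tallyOf-cong p≗r []       = refl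
  tallyOf-cong p≗r (w ∷ ws) =
    cong₂ (λ b y → (if b then (1 , ones w) else 0ᵗ) ⊕ y) (p≗r w) (tallyOf-cong p≗r ws)

  tally-const-false : ∀ n → tally (λ _ → false) n ≡ 0ᵗ
  tally-const-false n = go (words n)
    where
    go : ∀ ws → tallyOf (λ _ → false) ws ≡ 0ᵗ
    go []       = refl
    go (w ∷ ws) = go ws

  tally-∧ : ∀ b p n → tally (λ w → b ∧ p w) n ≡ (if b then tally p n else 0ᵗ)
  tally-∧ true  p n = refl
  tally-∧ false p n = tally-const-false n

  #ones-tallyOf : ∀ p ws → #ones (tallyOf p ws) ≡ sum (map ones (filterᵇ p ws))
  #ones-tallyOf p []       = refl
  #ones-tallyOf p (w ∷ ws) with p w
  ... | true  = cong (ones w +_) (#ones-tallyOf p ws)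
  ... | false = #ones-tallyOf p ws

  -- Runs X n m is the tally of the words of length n of the form 1^j 0 w with
  -- j < m and w counted by X (n ∸ j ∸ 1), together with 1^n when n < m.
  Runs : (ℕ → Tally) → ℕ → ℕ → Tally
  Runs X n       zero    = 0ᵗ
  Runs X zero    (suc m) = 1ᵗ
  Runs X (suc n) (suc m) = X n ⊕ prepend1 (Runs X n m)

  Runs-+ : ∀ X j n m → j ≤ n → Runs X n (j + m) ≡ Runs X n j ⊕ prepend1^ j (Runs X (n ∸ j) m)
  Runs-+ X zero    n       m _         = refl
  Runs-+ X (suc j) (suc n) m (s≤s j≤n) =
    trans (cong (λ z → X n ⊕ prepend1 z) (Runs-+ X j n m j≤n))
    (trans (cong (X n ⊕_) (prepend1-⊕ (Runs X n j) _))
    (sym (⊕-assoc (X n) _ _)))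

  Runs-saturated : ∀ X n j k → n < j → n < k → Runs X n j ≡ Runs X n k
  Runs-saturated X zero    (suc j) (suc k) _         _         = refl
  Runs-saturated X (suc n) (suc j) (suc k) (s≤s n<j) (s≤s n<k) =
    cong (λ z → X n ⊕ prepend1 z) (Runs-saturated X n j k n<j n<k)

  Runs-cong : ∀ {X Y} n m → (∀ k → k < n → X k ≡ Y k) → Runs X n m ≡ Runs Y n m
  Runs-cong n       zero    _   = refl
  Runs-cong zero    (suc m) _   = refl
  Runs-cong (suc n) (suc m) X≗Y =
    cong₂ (λ a b → a ⊕ prepend1 b) (X≗Y n ≤-refl)
          (Runs-cong n m (λ k k<n → X≗Y k (m≤n⇒m≤1+n k<n)))

  Runs-zero-∸ : ∀ X m k → Runs X 0 (m ∸ k) ≡ (if k <ᵇ m then 1ᵗ else 0ᵗ)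
  Runs-zero-∸ X zero    zero    = refl
  Runs-zero-∸ X (suc m) zero    = refl
  Runs-zero-∸ X zero    (suc k) = refl
  Runs-zero-∸ X (suc m) (suc k) = Runs-zero-∸ X m k

  Runs-suc-∸ : ∀ X n m k →
    Runs X (suc n) (m ∸ k) ≡ (if k <ᵇ m then X n else 0ᵗ) ⊕ prepend1 (Runs X n (m ∸ suc k))
  Runs-suc-∸ X n zero    zero    = refl
  Runs-suc-∸ X n (suc m) zero    = refl
  Runs-suc-∸ X n zero    (suc k) = refl
  Runs-suc-∸ X n (suc m) (suc k) = Runs-suc-∸ X n m k


  record Recurrence (q' : ℕ) (X : ℕ → Tally) : Set where
    field
      initial : X 0 ≡ 1ᵗ
      short   : ∀ n → n < suc q' → X (suc n) ≡ X n ⊕ prepend1 (Runs X n q')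
      long    : ∀ m → X (suc (m + suc q')) ≡
                  X (m + suc q') ⊕ prepend1^ (suc q') (X m) ⊕ prepend1 (Runs X (m + suc q') q')

  Recurrence-unique : ∀ {q' X Y} → Recurrence q' X → Recurrence q' Y → ∀ n → X n ≡ Y n
  Recurrence-unique {q'} {X} {Y} RX RY = <-rec (λ n → X n ≡ Y n) step
    where
    module RX = Recurrence RX
    module RY = Recurrence RY
    step : ∀ n → (∀ {k} → k < n → X k ≡ Y k) → X n ≡ Y n
    step zero    _  = trans RX.initial (sym RY.initial)
    step (suc n) ih with n <? suc q'
    ... | yes n<q = begin
      X (suc n)                    ≡⟨ RX.short n n<q ⟩
      X n ⊕ prepend1 (Runs X n q') ≡⟨ cong₂ (λ x y → x ⊕ prepend1 y) (ih ≤-refl) (Runs-cong n q' ih′) ⟩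
      Y n ⊕ prepend1 (Runs Y n q') ≡⟨ RY.short n n<q ⟨
      Y (suc n)                    ∎
      where
      open ≡-Reasoning
      ih′ : ∀ k → k < n → X k ≡ Y k
      ih′ k k<n = ih (m<n⇒m<1+n k<n)
    ... | no n≮q with n ∸ suc q' | m∸n+n≡m (≮⇒≥ n≮q)
    ...   | m | refl = begin
      X (suc (m + q))
        ≡⟨ RX.long m ⟩
      X (m + q) ⊕ prepend1^ q (X m) ⊕ prepend1 (Runs X (m + q) q')
        ≡⟨ cong₂ (λ x y → x ⊕ prepend1^ q y ⊕ prepend1 (Runs X (m + q) q'))
                 (ih ≤-refl) (ih (s≤s (m≤m+n m q))) ⟩
      Y (m + q) ⊕ prepend1^ q (Y m) ⊕ prepend1 (Runs X (m + q) q')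
        ≡⟨ cong (λ z → Y (m + q) ⊕ prepend1^ q (Y m) ⊕ prepend1 z) (Runs-cong (m + q) q' ih′) ⟩
      Y (m + q) ⊕ prepend1^ q (Y m) ⊕ prepend1 (Runs Y (m + q) q')
        ≡⟨ RY.long m ⟨
      Y (suc (m + q)) ∎
      where
      open ≡-Reasoning
      q = suc q'
      ih′ : ∀ k → k < m + q → X k ≡ Y k
      ih′ k k<n = ih (m<n⇒m<1+n k<n)

  runs≤ : ℕ → ℕ → Word → Bool
  runs≤ q k       []          = true
  runs≤ q k       (false ∷ w) = runs≤ q q w
  runs≤ q zero    (true ∷ w)  = false
  runs≤ q (suc k) (true ∷ w)  = runs≤ q k w

  1^ : ℕ → Word
  1^ j = replicate j true

  1^-++-true∷ : ∀ j w → 1^ j ++ true ∷ w ≡ 1^ (suc j) ++ w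
  1^-++-true∷ zero    w = refl
  1^-++-true∷ (suc j) w = cong (true ∷_) (1^-++-true∷ j w)

  isPrefix-1^-++ : ∀ j w → isPrefix (1^ j) (1^ j ++ w) ≡ true
  isPrefix-1^-++ zero    w = refl
  isPrefix-1^-++ (suc j) w = isPrefix-1^-++ j w

  isPrefix-1^-blocked : ∀ i j w → j < i → (∀ p → isPrefix (true ∷ p) w ≡ false) →
    isPrefix (1^ i) (1^ j ++ w) ≡ false
  isPrefix-1^-blocked (suc i) zero    w _         blocked = blocked (1^ i)
  isPrefix-1^-blocked (suc i) (suc j) w (s≤s j<i) blocked = isPrefix-1^-blocked i j w j<i blocked

  hasFactor-1^-blocked : ∀ i j w → j < i → (∀ p → isPrefix (true ∷ p) w ≡ false) →
    hasFactor (1^ i) (1^ j ++ w) ≡ hasFactor (1^ i) w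
  hasFactor-1^-blocked i zero    w _   _       = refl
  hasFactor-1^-blocked i (suc j) w j<i blocked =
    cong₂ _∨_ (isPrefix-1^-blocked i (suc j) w j<i blocked)
              (hasFactor-1^-blocked i j w (<⇒≤ j<i) blocked)

  hasFactor-1^-++ : ∀ q j k w → j + k ≡ q → hasFactor (1^ (suc q)) (1^ j ++ w) ≡ not (runs≤ q k w)
  hasFactor-1^-++ .(j + k) j k [] refl =
    hasFactor-1^-blocked (suc (j + k)) j [] (s≤s (m≤m+n j k)) (λ _ → refl)
  hasFactor-1^-++ .(j + k) j k (false ∷ w) refl =
    trans (hasFactor-1^-blocked (suc (j + k)) j (false ∷ w) (s≤s (m≤m+n j k)) (λ _ → refl))
          (hasFactor-1^-++ (j + k) 0 (j + k) w refl)
  hasFactor-1^-++ q j (suc k) (true ∷ w) j+k≡q =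
    trans (cong (hasFactor (1^ (suc q))) (1^-++-true∷ j w))
          (hasFactor-1^-++ q (suc j) k w (trans (sym (+-suc j k)) j+k≡q))
  hasFactor-1^-++ .(j + 0) j zero (true ∷ w) refl rewrite +-identityʳ j =
    trans (cong (hasFactor (1^ (suc j))) (1^-++-true∷ j w))
          (cong (_∨ hasFactor (1^ (suc j)) (1^ j ++ w)) (isPrefix-1^-++ (suc j) w))

  avoids1Run≡runs≤ : ∀ q w → avoids1Run q w ≡ runs≤ q q w
  avoids1Run≡runs≤ q w with runs≤ q q w | hasFactor-1^-++ q 0 q w refl
  ... | true  | eq = cong (λ b → if b then false else true) eq
  ... | false | eq = cong (λ b → if b then false else true) eq

  avoiding : ℕ → ℕ → Tally
  avoiding q = tally (runs≤ q q)

  tally-runs≤ : ∀ q k n → tally (runs≤ q k) n ≡ Runs (avoiding q) n (suc k)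
  tally-runs≤ q k       zero    = refl
  tally-runs≤ q zero    (suc n) =
    trans (tally-suc (runs≤ q zero) n) (cong (λ x → avoiding q n ⊕ prepend1 x) (tally-const-false n))
  tally-runs≤ q (suc k) (suc n) =
    trans (tally-suc (runs≤ q (suc k)) n) (cong (λ x → avoiding q n ⊕ prepend1 x) (tally-runs≤ q k n))

  avoiding-Runs : ∀ q n → avoiding q n ≡ Runs (avoiding q) n (suc q)
  avoiding-Runs q = tally-runs≤ q q

  avoidingShortLead : ℕ → ℕ → Tally
  avoidingShortLead q n = Runs (avoiding q) n q

  module _ (q : ℕ) where
    private
      A A⁻ : ℕ → Tally
      A  = avoiding q
      A⁻ = avoidingShortLead q

    avoiding-short : ∀ n → n < q → A n ≡ A⁻ n
    avoiding-short n n<q = trans (avoiding-Runs q n) (Runs-saturated A n (suc q) q (m<n⇒m<1+n n<q) n<q)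

    avoiding-long : ∀ i → A (i + q) ≡ A⁻ (i + q) ⊕ prepend1^ q (Runs A i 1)
    avoiding-long i = begin
      A (i + q)                                   ≡⟨ avoiding-Runs q (i + q) ⟩
      Runs A (i + q) (suc q)                      ≡⟨ cong (Runs A (i + q)) (+-comm 1 q) ⟩
      Runs A (i + q) (q + 1)                      ≡⟨ Runs-+ A q (i + q) 1 (m≤n+m q i) ⟩
      A⁻ (i + q) ⊕ prepend1^ q (Runs A (i + q ∸ q) 1)
        ≡⟨ cong (λ k → A⁻ (i + q) ⊕ prepend1^ q (Runs A k 1)) (m+n∸n≡m i q) ⟩
      A⁻ (i + q) ⊕ prepend1^ q (Runs A i 1)       ∎
      where open ≡-Reasoning

    Runs-avoiding-short : ∀ n r → n ≤ q → Runs A n r ≡ Runs A⁻ n r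
    Runs-avoiding-short n r n≤q = Runs-cong n r (λ k k<n → avoiding-short k (<-≤-trans k<n n≤q))

    Runs-avoiding-long : ∀ i r →
      Runs A (suc (i + q)) r ≡ Runs A⁻ (suc (i + q)) r ⊕ prepend1^ q (Runs A i r)
    Runs-avoiding-long i       zero    = cong (0ᵗ ⊕_) (sym (prepend1^-no-words q 0))
    Runs-avoiding-long zero    (suc r) = begin
      A q ⊕ prepend1 (Runs A q r)
        ≡⟨ cong₂ (λ x y → x ⊕ prepend1 y) (avoiding-long 0) (Runs-avoiding-short q r ≤-refl) ⟩
      A⁻ q ⊕ prepend1^ q 1ᵗ ⊕ prepend1 (Runs A⁻ q r)
        ≡⟨ xy∙z≈xz∙y (A⁻ q) (prepend1^ q 1ᵗ) (prepend1 (Runs A⁻ q r)) ⟩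
      A⁻ q ⊕ prepend1 (Runs A⁻ q r) ⊕ prepend1^ q 1ᵗ ∎
      where open ≡-Reasoning
    Runs-avoiding-long (suc i) (suc r) = begin
      A (suc i + q) ⊕ prepend1 (Runs A (suc (i + q)) r)
        ≡⟨ cong₂ (λ x y → x ⊕ prepend1 y) (avoiding-long (suc i)) (Runs-avoiding-long i r) ⟩
      L ⊕ sh (A i ⊕ 0ᵗ) ⊕ prepend1 (R⁻ ⊕ sh R)
        ≡⟨ cong₂ (λ x y → L ⊕ sh x ⊕ y) (⊕-identityʳ (A i)) (prepend1-⊕ R⁻ (sh R)) ⟩
      L ⊕ sh (A i) ⊕ (prepend1 R⁻ ⊕ prepend1 (sh R))
        ≡⟨ interchange L (sh (A i)) (prepend1 R⁻) (prepend1 (sh R)) ⟩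
      L ⊕ prepend1 R⁻ ⊕ (sh (A i) ⊕ prepend1 (sh R))
        ≡⟨ cong (λ x → L ⊕ prepend1 R⁻ ⊕ (sh (A i) ⊕ x)) (prepend1^-prepend1 q R) ⟨
      L ⊕ prepend1 R⁻ ⊕ (sh (A i) ⊕ sh (prepend1 R))
        ≡⟨ cong (L ⊕ prepend1 R⁻ ⊕_) (prepend1^-⊕ q (A i) (prepend1 R)) ⟨
      L ⊕ prepend1 R⁻ ⊕ sh (A i ⊕ prepend1 R) ∎
      where
      open ≡-Reasoning
      sh = prepend1^ q
      L  = A⁻ (suc i + q)
      R⁻ = Runs A⁻ (suc (i + q)) r
      R  = Runs A i r

  avoidingShortLead-Recurrence : ∀ q' → Recurrence q' (avoidingShortLead (suc q'))
  avoidingShortLead-Recurrence q' = record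
    { initial = refl
    ; short   = λ n n<q → Runs-avoiding-short q (suc n) q n<q
    ; long    = λ m → trans (Runs-avoiding-long q m q)
                            (xy∙z≈xz∙y (A⁻ (m + q)) (E m) (prepend1^ q (A⁻ m)))
    }
    where
    q = suc q'
    A⁻ = avoidingShortLead q
    E : ℕ → Tally
    E m = prepend1 (Runs A⁻ (m + q) q')

  -- afterZeros q a n tallies the words w of length n such that 0^a w is q-decreasing.
  afterZeros : ℕ → ℕ → ℕ → Tally
  afterZeros q a = tally (blockCheck q a 0)

  tally-blockCheck-ones : ∀ q a b n →
    tally (blockCheck q a (suc b)) n ≡ Runs (afterZeros q 1) n (q * a ∸ suc b)
  tally-blockCheck-ones q a b zero =
    trans (⊕-identityʳ _) (sym (Runs-zero-∸ (afterZeros q 1) (q * a) (suc b)))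
  tally-blockCheck-ones q a b (suc n) = begin
    tally (blockCheck q a (suc b)) (suc n)
      ≡⟨ tally-suc (blockCheck q a (suc b)) n ⟩
    tally (λ w → lt ∧ blockCheck q 1 0 w) n ⊕ prepend1 (tally (blockCheck q a (suc (suc b))) n)
      ≡⟨ cong₂ (λ x y → x ⊕ prepend1 y)
               (tally-∧ lt (blockCheck q 1 0) n) (tally-blockCheck-ones q a (suc b) n) ⟩
    (if lt then afterZeros q 1 n else 0ᵗ) ⊕ prepend1 (Runs (afterZeros q 1) n (q * a ∸ suc (suc b)))
      ≡⟨ Runs-suc-∸ (afterZeros q 1) n (q * a) (suc b) ⟨
    Runs (afterZeros q 1) (suc n) (q * a ∸ suc b) ∎
    where
    open ≡-Reasoning
    lt = suc b <ᵇ q * a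

  module _ (q' : ℕ) where
    private
      q : ℕ
      q = suc q'
      Z : ℕ → ℕ → Tally
      Z a = afterZeros q a
      P : ℕ → Tally
      P = afterZeros q 1
      budget : ∀ q' a → a + q' * suc a ≡ q' + suc q' * a
      budget = solve-∀

    afterZeros-suc : ∀ a n → Z (suc a) (suc n) ≡ Z (suc (suc a)) n ⊕ prepend1 (Runs P n (q' + q * a))
    afterZeros-suc a n =
      trans (tally-suc (blockCheck q (suc a) 0) n)
            (cong (λ x → Z (suc (suc a)) n ⊕ prepend1 x)
                  (trans (tally-blockCheck-ones q (suc a) 0 n) (cong (Runs P n) (budget q' a))))

    afterZero-suc : ∀ n → P (suc n) ≡ Z 2 n ⊕ prepend1 (Runs P n q')
    afterZero-suc n =
      trans (afterZeros-suc 0 n)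
            (cong (λ k → Z 2 n ⊕ prepend1 (Runs P n k)) (trans (cong (q' +_) (*-zeroʳ q)) (+-identityʳ q')))

    afterZeros-short : ∀ a n → n < q → Z (suc (suc a)) n ≡ P n
    afterZeros-short a zero    _         = refl
    afterZeros-short a (suc n) (s≤s n<q') = begin
      Z (suc (suc a)) (suc n)
        ≡⟨ afterZeros-suc (suc a) n ⟩
      Z (suc (suc (suc a))) n ⊕ prepend1 (Runs P n (q' + q * suc a))
        ≡⟨ cong₂ (λ x y → x ⊕ prepend1 y) (afterZeros-short (suc a) n (m<n⇒m<1+n n<q'))
                                            (Runs-saturated P n _ _ (≤-trans n<q' (m≤m+n q' _)) n<q') ⟩
      P n ⊕ prepend1 (Runs P n q')
        ≡⟨ cong (_⊕ prepend1 (Runs P n q')) (afterZeros-short 0 n (m<n⇒m<1+n n<q')) ⟨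
      Z 2 n ⊕ prepend1 (Runs P n q')
        ≡⟨ afterZero-suc n ⟨
      P (suc n) ∎
      where open ≡-Reasoning

    afterZero-short-step : ∀ n → n < q → P (suc n) ≡ P n ⊕ prepend1 (Runs P n q')
    afterZero-short-step n n<q =
      trans (afterZero-suc n) (cong (_⊕ prepend1 (Runs P n q')) (afterZeros-short 0 n n<q))

    prepend1-Runs-budget : ∀ a n → q' ≤ n →
      prepend1 (Runs P n (q' + q * suc a)) ≡
      prepend1 (Runs P n q') ⊕ prepend1^ q (Runs P (n ∸ q') (q * suc a))
    prepend1-Runs-budget a n q'≤n =
      trans (cong prepend1 (Runs-+ P q' n (q * suc a) q'≤n))
            (prepend1-⊕ (Runs P n q') (prepend1^ q' (Runs P (n ∸ q') (q * suc a))))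

    afterZeros-long : ∀ a m → Z (suc (suc a)) (m + q) ≡ P (m + q) ⊕ prepend1^ q (Z (suc a) m)
    afterZeros-long a zero = begin
      Z (suc (suc a)) q
        ≡⟨ afterZeros-suc (suc a) q' ⟩
      Z (suc (suc (suc a))) q' ⊕ prepend1 (Runs P q' (q' + q * suc a))
        ≡⟨ cong₂ _⊕_ (afterZeros-short (suc a) q' ≤-refl) (prepend1-Runs-budget a q' ≤-refl) ⟩
      P q' ⊕ (E ⊕ prepend1^ q (Runs P (q' ∸ q') (q * suc a)))
        ≡⟨ cong (λ k → P q' ⊕ (E ⊕ prepend1^ q (Runs P k (q * suc a)))) (n∸n≡0 q') ⟩
      P q' ⊕ (E ⊕ prepend1^ q 1ᵗ)
        ≡⟨ ⊕-assoc (P q') E (prepend1^ q 1ᵗ) ⟨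
      P q' ⊕ E ⊕ prepend1^ q 1ᵗ
        ≡⟨ cong (_⊕ prepend1^ q 1ᵗ) (afterZero-short-step q' ≤-refl) ⟨
      P q ⊕ prepend1^ q 1ᵗ ∎
      where
      open ≡-Reasoning
      E = prepend1 (Runs P q' q')
    afterZeros-long a (suc m) = begin
      Z (suc (suc a)) (suc (m + q))
        ≡⟨ afterZeros-suc (suc a) (m + q) ⟩
      Z (suc (suc (suc a))) (m + q) ⊕ prepend1 (Runs P (m + q) (q' + q * suc a))
        ≡⟨ cong₂ _⊕_ (afterZeros-long (suc a) m) (prepend1-Runs-budget a (m + q) q'≤m+q) ⟩
      P (m + q) ⊕ sh S ⊕ (E ⊕ sh (Runs P (m + q ∸ q') (q * suc a)))
        ≡⟨ cong (λ k → P (m + q) ⊕ sh S ⊕ (E ⊕ sh (Runs P k (q * suc a)))) (m+q∸q'≡1+m m) ⟩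
      P (m + q) ⊕ sh S ⊕ (E ⊕ sh (T ⊕ prepend1 (Runs P m (a + q' * suc a))))
        ≡⟨ cong (λ k → P (m + q) ⊕ sh S ⊕ (E ⊕ sh (T ⊕ prepend1 (Runs P m k)))) (budget q' a) ⟩
      P (m + q) ⊕ sh S ⊕ (E ⊕ sh (T ⊕ U))
        ≡⟨ cong (λ x → P (m + q) ⊕ sh S ⊕ (E ⊕ x)) (prepend1^-⊕ q T U) ⟩
      P (m + q) ⊕ sh S ⊕ (E ⊕ (sh T ⊕ sh U))
        ≡⟨ rearrange (P (m + q)) (sh S) E (sh T) (sh U) ⟩
      P (m + q) ⊕ sh T ⊕ E ⊕ (sh S ⊕ sh U)
        ≡⟨ cong₂ (λ x y → x ⊕ E ⊕ y) (afterZeros-long 0 m) (prepend1^-⊕ q S U) ⟨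
      Z 2 (m + q) ⊕ E ⊕ sh (S ⊕ U)
        ≡⟨ cong₂ (λ x y → x ⊕ sh y) (afterZero-suc (m + q)) (afterZeros-suc a m) ⟨
      P (suc (m + q)) ⊕ sh (Z (suc a) (suc m)) ∎
      where
      open ≡-Reasoning
      sh = prepend1^ q
      S = Z (suc (suc a)) m
      E = prepend1 (Runs P (m + q) q')
      T = P m
      U = prepend1 (Runs P m (q' + q * a))
      q'≤m+q : q' ≤ m + q
      q'≤m+q = ≤-trans (n≤1+n q') (m≤n+m q m)
      m+q∸q'≡1+m : ∀ m → m + q ∸ q' ≡ suc m
      m+q∸q'≡1+m m = trans (cong (_∸ q') (+-suc m q')) (m+n∸n≡m (suc m) q')
      rearrange : ∀ p s e t u → p ⊕ s ⊕ (e ⊕ (t ⊕ u)) ≡ p ⊕ t ⊕ e ⊕ (s ⊕ u)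
      rearrange =
        solve 5 (λ p s e t u → (p ⊕ᵉ s) ⊕ᵉ (e ⊕ᵉ (t ⊕ᵉ u)) ⊜ ((p ⊕ᵉ t) ⊕ᵉ e) ⊕ᵉ (s ⊕ᵉ u)) refl

    afterZero-Recurrence : Recurrence q' P
    afterZero-Recurrence = record
      { initial = refl
      ; short   = afterZero-short-step
      ; long    = λ m → trans (afterZero-suc (m + q))
                              (cong (_⊕ prepend1 (Runs P (m + q) q')) (afterZeros-long 0 m))
      }

  afterZero≡avoidingShortLead : ∀ q' n → afterZeros (suc q') 1 n ≡ avoidingShortLead (suc q') n
  afterZero≡avoidingShortLead q' =
    Recurrence-unique (afterZero-Recurrence q') (avoidingShortLead-Recurrence q')

  decreasing : ℕ → ℕ → Tally
  decreasing q = tally (isQDecreasing q)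

  decreasing-Runs : ∀ q n m → n < m → decreasing q n ≡ Runs (afterZeros q 1) n m
  decreasing-Runs q zero    (suc m) _         = refl
  decreasing-Runs q (suc n) (suc m) (s≤s n<m) =
    trans (tally-suc (isQDecreasing q) n)
          (cong (λ x → afterZeros q 1 n ⊕ prepend1 x) (decreasing-Runs q n m n<m))

  #words-Runs-head : ∀ X n m → #words (X n) ≤ #words (Runs X (suc n) (suc m))
  #words-Runs-head X n m = m≤m+n (#words (X n)) _

  #words-avoiding-mono : ∀ q {i j} → i ≤ j → #words (avoiding q i) ≤ #words (avoiding q j)
  #words-avoiding-mono q i≤j = go (≤⇒≤′ i≤j)
    where
    go : ∀ {i j} → i ≤′ j → #words (avoiding q i) ≤ #words (avoiding q j)
    go ≤′-refl             = ≤-refl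
    go (≤′-step {n} i≤′n) =
      ≤-trans (go i≤′n)
              (subst (λ x → #words (avoiding q n) ≤ #words x) (sym (avoiding-Runs q (suc n)))
                     (#words-Runs-head (avoiding q) n q))

  module _ (q' : ℕ) where
    private
      q : ℕ
      q = suc q'
      A A⁻ Q : ℕ → Tally
      A  = avoiding q
      A⁻ = avoidingShortLead q
      Q  = decreasing q

    decreasing-Runs-avoiding : ∀ n m → n < m → Q n ≡ Runs A⁻ n m
    decreasing-Runs-avoiding n m n<m =
      trans (decreasing-Runs q n m n<m) (Runs-cong n m (λ k _ → afterZero≡avoidingShortLead q' k))

    decreasing-short : ∀ n → n ≤ q → Q n ≡ A n
    decreasing-short n n≤q = begin
      Q n               ≡⟨ decreasing-Runs-avoiding n (suc q) (s≤s n≤q) ⟩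
      Runs A⁻ n (suc q) ≡⟨ Runs-avoiding-short q n (suc q) n≤q ⟨
      Runs A n (suc q)  ≡⟨ avoiding-Runs q n ⟨
      A n               ∎
      where open ≡-Reasoning

    decreasing-long : ∀ i → Q (suc (i + q)) ≡ Runs A⁻ (suc (i + q)) (suc q) ⊕ prepend1^ (suc q) (Q i)
    decreasing-long i = begin
      Q n
        ≡⟨ decreasing-Runs-avoiding n (suc q + suc i) (s≤s (≤-reflexive length)) ⟩
      Runs A⁻ n (suc q + suc i)
        ≡⟨ Runs-+ A⁻ (suc q) n (suc i) (s≤s (m≤n+m q i)) ⟩
      R ⊕ sh (Runs A⁻ (i + q ∸ q) (suc i))
        ≡⟨ cong (λ k → R ⊕ sh (Runs A⁻ k (suc i))) (m+n∸n≡m i q) ⟩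
      R ⊕ sh (Runs A⁻ i (suc i))
        ≡⟨ cong (λ x → R ⊕ sh x) (decreasing-Runs-avoiding i (suc i) ≤-refl) ⟨
      R ⊕ sh (Q i) ∎
      where
      open ≡-Reasoning
      n = suc (i + q)
      R = Runs A⁻ n (suc q)
      sh = prepend1^ (suc q)
      length : suc (i + q) ≡ q + suc i
      length = trans (cong suc (+-comm i q)) (sym (+-suc q i))

    avoiding-long-Runs : ∀ i → A (suc (i + q)) ≡ Runs A⁻ (suc (i + q)) (suc q) ⊕ prepend1^ q (A i)
    avoiding-long-Runs i =
      trans (avoiding-Runs q (suc (i + q)))
            (trans (Runs-avoiding-long q i (suc q))
                   (cong (λ x → Runs A⁻ (suc (i + q)) (suc q) ⊕ prepend1^ q x) (sym (avoiding-Runs q i))))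

    #words-avoiding≤Runs : ∀ i → #words (A i) ≤ #words (Runs A⁻ (suc (i + q)) (suc q))
    #words-avoiding≤Runs i = begin
      #words (A i)                                ≤⟨ #words-avoiding-mono q (m≤m+n i q') ⟩
      #words (A (i + q'))                         ≤⟨ #words-Runs-head A (i + q') q' ⟩
      #words (A⁻ (suc (i + q')))                  ≡⟨ cong (λ k → #words (A⁻ k)) (+-suc i q') ⟨
      #words (A⁻ (i + q))                         ≤⟨ #words-Runs-head A⁻ (i + q) q ⟩
      #words (Runs A⁻ (suc (i + q)) (suc q))      ∎
      where open ≤-Reasoning

    decreasing-excess : ∀ n → ∃[ t ] (Q n ≡ A n ⊕ (0 , t) × t ≤ #words (A n))
    decreasing-excess = <-rec _ step
      where
      no-excess : ∀ n → n ≤ q → ∃[ t ] (Q n ≡ A n ⊕ (0 , t) × t ≤ #words (A n))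
      no-excess n n≤q = 0 , trans (decreasing-short n n≤q) (sym (⊕-identityʳ (A n))) , z≤n
      step : ∀ n → (∀ {k} → k < n → ∃[ t ] (Q k ≡ A k ⊕ (0 , t) × t ≤ #words (A k))) →
             ∃[ t ] (Q n ≡ A n ⊕ (0 , t) × t ≤ #words (A n))
      step zero    _  = no-excess 0 z≤n
      step (suc n) ih with n <? q
      ... | yes n<q = no-excess (suc n) n<q
      ... | no n≮q with n ∸ q | m∸n+n≡m (≮⇒≥ n≮q)
      ...   | i | refl with ih (s≤s (m≤m+n i q))
      ...     | t , Qi≡Ai⊕t , t≤ = #words (A i) + t , excess-eq , bound
        where
        R = Runs A⁻ (suc (i + q)) (suc q)
        excess-eq : Q (suc (i + q)) ≡ A (suc (i + q)) ⊕ (0 , #words (A i) + t)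
        excess-eq = begin
          Q (suc (i + q))                       ≡⟨ decreasing-long i ⟩
          R ⊕ prepend1^ (suc q) (Q i)           ≡⟨ cong (λ x → R ⊕ prepend1^ (suc q) x) Qi≡Ai⊕t ⟩
          R ⊕ prepend1^ (suc q) (A i ⊕ (0 , t)) ≡⟨ cong (R ⊕_) (prepend1^-suc-⊕ q (A i) t) ⟩
          R ⊕ (prepend1^ q (A i) ⊕ excess)      ≡⟨ ⊕-assoc R (prepend1^ q (A i)) excess ⟨
          R ⊕ prepend1^ q (A i) ⊕ excess        ≡⟨ cong (_⊕ excess) (avoiding-long-Runs i) ⟨
          A (suc (i + q)) ⊕ excess              ∎
          where
          open ≡-Reasoning
          excess = 0 , #words (A i) + t
        bound : #words (A i) + t ≤ #words (A (suc (i + q)))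
        bound = begin
          #words (A i) + t
            ≤⟨ +-monoʳ-≤ (#words (A i)) (≤-trans t≤ (#words-avoiding≤Runs i)) ⟩
          #words (A i) + #words R                   ≡⟨ +-comm (#words (A i)) (#words R) ⟩
          #words R + #words (A i)                   ≡⟨ cong (#words R +_) (#words-prepend1^ q (A i)) ⟨
          #words (R ⊕ prepend1^ q (A i))            ≡⟨ cong #words (avoiding-long-Runs i) ⟨
          #words (A (suc (i + q)))                  ∎
          where open ≤-Reasoning

  <⇒<ᵇ≡true : ∀ {m n} → m < n → (m <ᵇ n) ≡ true
  <⇒<ᵇ≡true m<n = Equivalence.to T-≡ (<⇒<ᵇ m<n)

  ≤⇒<ᵇ≡false : ∀ {m n} → n ≤ m → (m <ᵇ n) ≡ false
  ≤⇒<ᵇ≡false z≤n             = refl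
  ≤⇒<ᵇ≡false (s≤s z≤n)       = refl
  ≤⇒<ᵇ≡false (s≤s (s≤s n≤m)) = ≤⇒<ᵇ≡false (s≤s n≤m)

  ≡ᵇ-refl : ∀ m → (m ≡ᵇ m) ≡ true
  ≡ᵇ-refl m = Equivalence.to T-≡ (≡⇒≡ᵇ m m refl)

  <⇒≡ᵇ≡false : ∀ {m n} → n < m → (m ≡ᵇ n) ≡ false
  <⇒≡ᵇ≡false {suc m} {zero}  _         = refl
  <⇒≡ᵇ≡false {suc m} {suc n} (s≤s n<m) = <⇒≡ᵇ≡false n<m

  sum-take-replicate-0 : ∀ m r → sum (take m (replicate r 0)) ≡ 0
  sum-take-replicate-0 zero    r       = refl
  sum-take-replicate-0 (suc m) zero    = refl
  sum-take-replicate-0 (suc m) (suc r) = sum-take-replicate-0 m r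

  module _ (q' : ℕ) where
    private
      q : ℕ
      q = suc q'
      A : ℕ → Tally
      A = avoiding q

    fibHist-initial : ∀ j → j < q → fibHist (suc q) j ≡ replicate (suc j) 0
    fibHist-initial zero    _         = refl
    fibHist-initial (suc j) (s≤s j<q') rewrite <⇒<ᵇ≡true (s≤s j<q') =
      cong (0 ∷_) (fibHist-initial j (m<n⇒m<1+n j<q'))

    fibVal-recurrence : ∀ n hist → fibVal (suc q) (suc (n + q)) hist ≡ sum (take (suc q) hist)
    fibVal-recurrence n hist
      rewrite ≤⇒<ᵇ≡false (≤-trans (n≤1+n q') (m≤n+m q n)) | <⇒≡ᵇ≡false (m≤n+m q n) = refl

    #words-Runs-avoiding : ∀ n m → #words (Runs A n m) ≡ sum (take m (fibHist (suc q) (n + q)))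
    #words-Runs-avoiding zero    zero    = refl
    #words-Runs-avoiding zero    (suc m)
      rewrite ≤⇒<ᵇ≡false (≤-refl {q'}) | ≡ᵇ-refl q' | fibHist-initial q' ≤-refl =
      sym (cong suc (sum-take-replicate-0 m q))
    #words-Runs-avoiding (suc n) zero    = refl
    #words-Runs-avoiding (suc n) (suc m) = cong₂ _+_ head (#words-Runs-avoiding n m)
      where
      head : #words (A n) ≡ fibVal (suc q) (suc (n + q)) (fibHist (suc q) (n + q))
      head = begin
        #words (A n)                                   ≡⟨ cong #words (avoiding-Runs q n) ⟩
        #words (Runs A n (suc q))                      ≡⟨ #words-Runs-avoiding n (suc q) ⟩
        sum (take (suc q) (fibHist (suc q) (n + q)))   ≡⟨ fibVal-recurrence n (fibHist (suc q) (n + q)) ⟨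
        fibVal (suc q) (suc (n + q)) (fibHist (suc q) (n + q)) ∎
        where open ≡-Reasoning

    -- The head of fibHist counts the words 0w of length n + 1 with w avoiding 1^(q+1).
    f≡#words-avoiding : ∀ n → f (n + q + 1) (q + 1) ≡ #words (A n)
    f≡#words-avoiding n rewrite +-comm q 1 | +-comm (n + q) 1 =
      +-cancelʳ-≡ 0 _ _ (sym (#words-Runs-avoiding (suc n) 1))

  v≡#ones-avoiding : ∀ q n → v n q ≡ #ones (avoiding q n)
  v≡#ones-avoiding q n =
    trans (sym (#ones-tallyOf (avoids1Run q) (words n)))
          (cong #ones (tallyOf-cong (avoids1Run≡runs≤ q) (words n)))

  u≡v+excess : ∀ q' n →
    ∃[ t ] (u n (suc q') ≡ v n (suc q') + t × t ≤ f (n + suc q' + 1) (suc q' + 1))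
  u≡v+excess q' n with decreasing-excess q' n
  ... | t , Q≡A⊕t , t≤#A =
    t , trans (sym (#ones-tallyOf (isQDecreasing q) (words n)))
              (trans (cong #ones Q≡A⊕t) (cong (_+ t) (sym (v≡#ones-avoiding q n))))
      , subst (t ≤_) (sym (f≡#words-avoiding q' n)) t≤#A
    where q = suc q'

  f-positive : ∀ q' n → 0 < f (n + suc q' + 1) (suc q' + 1)
  f-positive q' n =
    subst (0 <_) (sym (f≡#words-avoiding q' n)) (#words-avoiding-mono (suc q') (z≤n {n}))

open Counting using (u≡v+excess; f-positive)

open import Data.Nat using (ℕ; _≤_; _+_; _*_)
open import Data.Integer using (+_; _-_)
open import Data.Rational using (ℚ; _/_; 0ℚ; ∣_∣; _<_) renaming (_*_ to _*ℚ_)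
open import Data.Product using (∃-syntax)

open import Data.Nat as ℕ using (suc; zero)
import Data.Nat.Properties as ℕ
import Data.Nat.Coprimality as C
open import Data.Integer as ℤ using (-[1+_]; +<+; _⊖_)
import Data.Integer.Properties as ℤ
open import Data.Rational using (mkℚ; *<*)
open import Data.Rational.Properties using (normalize-coprime; toℚᵘ-cancel-<; toℚᵘ-homo-*)
import Data.Rational.Unnormalised as ℚᵘ
import Data.Rational.Unnormalised.Properties as ℚᵘ
open import Data.Product using (_,_)
open import Relation.Binary.PropositionalEquality

ℕ/1≡mkℚ : ∀ m → + m / 1 ≡ mkℚ (+ m) 0 (C.sym (C.1-coprimeTo m))
ℕ/1≡mkℚ m = normalize-coprime (C.sym (C.1-coprimeTo m))

∣[a+t-a]/1∣≡t/1 : ∀ a t → ∣ ((+ (a + t)) - (+ a)) / 1 ∣ ≡ + t / 1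
∣[a+t-a]/1∣≡t/1 a t = begin
  ∣ ((+ (a + t)) - (+ a)) / 1 ∣   ≡⟨ cong (λ z → ∣ z / 1 ∣) a+t-a≡t ⟩
  ∣ + t / 1 ∣                     ≡⟨ cong ∣_∣ (ℕ/1≡mkℚ t) ⟩
  mkℚ (+ t) 0 _                   ≡⟨ ℕ/1≡mkℚ t ⟨
  + t / 1                         ∎
  where
  open ≡-Reasoning
  a+t-a≡t : (+ (a + t)) - (+ a) ≡ + t
  a+t-a≡t = trans (ℤ.m-n≡m⊖n (a + t) a)
           (trans (cong ((a + t) ⊖_) (sym (ℕ.+-identityʳ a))) (ℤ.+-cancelˡ-⊖ a t 0))

ℕ/1<pos*ℕ/1 : ∀ p d .(c : C.Coprime (suc p) (suc d)) t M → t * suc d ℕ.< suc p * M →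
  + t / 1 < mkℚ (+ suc p) d c *ℚ (+ M / 1)
ℕ/1<pos*ℕ/1 p d c t M td<pM rewrite ℕ/1≡mkℚ t | ℕ/1≡mkℚ M =
  toℚᵘ-cancel-< (ℚᵘ.<-respʳ-≃ (ℚᵘ.≃-sym (toℚᵘ-homo-* ε M/1)) (ℚᵘ.*<* cross))
  where
  ε = mkℚ (+ suc p) d c
  M/1 = mkℚ (+ M) 0 (C.sym (C.1-coprimeTo M))
  cross : + t ℤ.* + suc (d * 1) ℤ.< (+ suc p ℤ.* + M) ℤ.* + 1
  cross rewrite ℕ.*-identityʳ d | ℤ.*-identityʳ (+ suc p ℤ.* + M)
              | sym (ℤ.pos-* t (suc d)) | sym (ℤ.pos-* (suc p) M) = +<+ td<pM

eventually-t/1<ε*[n*F]/1 : ∀ (ε : ℚ) → 0ℚ < ε →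
  ∃[ N ] (∀ n t F → N ≤ n → t ≤ F → 0 ℕ.< F → + t / 1 < ε *ℚ (+ (n * F) / 1))
eventually-t/1<ε*[n*F]/1 (mkℚ (+ zero)  _ _) (*<* (+<+ ()))
eventually-t/1<ε*[n*F]/1 (mkℚ -[1+ _ ]  _ _) (*<* ())
eventually-t/1<ε*[n*F]/1 (mkℚ (+ suc p) d c) _ =
  suc (suc d) , λ n t F d+1<n t≤F 0<F → ℕ/1<pos*ℕ/1 p d c t (n * F) (bound n t F d+1<n t≤F 0<F)
  where
  bound : ∀ n t F → suc (suc d) ≤ n → t ≤ F → 0 ℕ.< F → t * suc d ℕ.< suc p * (n * F)
  bound n t F@(suc _) d+1<n t≤F _ = begin-strict
    t * suc d         ≤⟨ ℕ.*-monoˡ-≤ (suc d) t≤F ⟩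
    F * suc d         <⟨ ℕ.*-monoʳ-< F d+1<n ⟩
    F * n             ≡⟨ ℕ.*-comm F n ⟩
    n * F             ≤⟨ ℕ.m≤n*m (n * F) (suc p) ⟩
    suc p * (n * F)   ∎
    where open ℕ.≤-Reasoning

corollary5 : (q : ℕ) → 1 ≤ q → (ε : ℚ) → 0ℚ < ε →
    ∃[ N ] ((n : ℕ) → N ≤ n →
      ∣ ((+ u n q) - (+ v n q)) / 1 ∣ < ε *ℚ ((+ (n * f (n + q + 1) (q + 1))) / 1))
corollary5 (suc q') _ ε 0<ε with eventually-t/1<ε*[n*F]/1 ε 0<ε
... | N , below = N , λ n N≤n →
  let q = suc q'
      F = f (n + q + 1) (q + 1)
      t , u≡v+t , t≤F = u≡v+excess q' n
  in subst (λ x → ∣ ((+ x) - (+ v n q)) / 1 ∣ < ε *ℚ (+ (n * F) / 1)) (sym u≡v+t)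
       (subst (_< ε *ℚ (+ (n * F) / 1)) (sym (∣[a+t-a]/1∣≡t/1 (v n q) t))
              (below n t F N≤n t≤F (f-positive q' n)))
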